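{- Let $w$ be a finite OP word, $T_w=\tau(w)$, and $\varphi,\psi$ formulas of $\mathcal{X}_{until}$ such that for every position $i'$ of $w$, $(T_w,\tau(i'))\models\varphi$ iff $(w,i')\models\iota(\varphi)$, and $(T_w,\tau(i'))\models\psi$ iff $(w,i')\models\iota(\psi)$. Then for every position $i$ of $w$, $(T_w,\tau(i))\models\Leftarrow(\varphi,\psi)$ iff $(w,i)\models\iota(\Leftarrow(\varphi,\psi))$, where, with $\varphi'=\iota(\varphi)$ and $\psi'=\iota(\psi)$, $\iota(\Leftarrow(\varphi,\psi))=\ominus^u_H(\varphi'\,\mathcal{S}^u_H\,\psi')\lor\ominus^{\doteq}_\chi\big(\bigcirc^{\lessdot}_\chi(\neg\bigcirc^u_H\top\land\varphi'\,\mathcal{S}^u_H\,\psi')\big)\lor\big(\ominus^{\lessdot}_\chi(\bigcirc^{\lessdot}\psi')\land\neg\ominus^u_H(\top\,\mathcal{S}^u_H\,\neg\varphi')\big)\lor\ominus^{\doteq}_\chi\big(\bigcirc^{\lessdot}\psi'\land\neg\bigcirc^{\lessdot}_\chi\neg\varphi'\big)$.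
   Context: OP words: $AP$ finite set of atomic propositions, $\Sigma=2^{AP}$, $\#\notin\Sigma$ a delimiter. An OPM $M$ is a partial function $(\Sigma\cup\{\#\})^2\to\{\lessdot,\doteq,\gtrdot\}$, writing $a\mathrel{\pi}b$ when $M(a,b)=\pi$; by convention $\#\lessdot a$, $a\gtrdot\#$. A simple chain is $c_0c_1\dots c_\ell c_{\ell+1}$ ($\ell\ge1$), $c_0,c_{\ell+1}\in\Sigma\cup\{\#\}$, $c_1..c_\ell\in\Sigma$, $c_0\lessdot c_1\doteq\dots\doteq c_\ell\gtrdot c_{\ell+1}$; a composed chain is $c_0s_0c_1\dots c_\ell s_\ell c_{\ell+1}$ with $c_0\dots c_{\ell+1}$ simple and each $s_k$ empty or $c_ks_kc_{k+1}$ a chain; $c_0,c_{\ell+1}$ are left/right contexts. $w\in\Sigma^*$ is compatible with $M$ if $M$ is defined on consecutive letter pairs and on contexts of every chain that is a substring of $\#w\#$. A finite OP word is such $w=w_1\dots w_n$ on positions $\{0,\dots,n+1\}$ with $\#$ at $0,n+1$ (atomic proposition $\#$ true exactly there) and label $w_k$ at $k$; $i\mathrel{\pi}j$ compares labels; $\chi(i,j)$ iff $i<j-1$ and $i,j$ are left and right contexts of the same chain occurring in $\#w\#$. Trees: an unranked ordered tree (UOT) has node set $S$ of finite sequences of naturals, prefix-closed, with $s\cdot k\in S$, $k>0$ implying $s\cdot(k-1)\in S$; child relation $s R_\Downarrow s\cdot k$; next-sibling relation $r\cdot h\,R_\Rightarrow\,r\cdot(h+1)$; $R_\Uparrow,R_\Leftarrow$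 are their inverses; nodes labeled by sets of atomic propositions; $R^+_\rho$ is the transitive closure. $\tau(w)$: position $0$ is the root; for each position $i$: if $i\doteq i+1$, $\tau(i+1)$ is the only child of $\tau(i)$; if $i\gtrdot i+1$, $\tau(i)$ is a leaf; if $i\lessdot i+1$, the children of $\tau(i)$ in order are $\tau(i+1),\tau(j_1),\dots,\tau(j_m)$ where $j_1<\dots<j_m$ are all positions with $\chi(i,j_k)$ and ($i\lessdot j_k$ or $i\doteq j_k$). Node $\tau(i)$ gets the label of $i$. $\mathcal{X}_{until}$: $\varphi::=\mathrm{a}\mid\top\mid\neg\varphi\mid\varphi\land\varphi\mid\rho(\varphi,\varphi)$, $\rho\in\{\Downarrow,\Uparrow,\Rightarrow,\Leftarrow\}$; $(T,s)\models\rho(\varphi,\psi)$ iff there is $t$ with $sR^+_\rho t$, $(T,t)\models\psi$, and every $r$ with $sR^+_\rho r$ and $rR^+_\rho t$ satisfies $\varphi$. POTL semantics at position $i$ (operators needed): $\bigcirc^d\theta$: $i+1$ exists, ($i\lessdot i+1$ or $i\doteq i+1$), $\theta$ at $i+1$; $\ominus^d\theta$: $i\ge1$, ($i-1\lessdot i$ or $i-1\doteq i$), $\theta$ at $i-1$. $\bigcirc^d_\chi\theta$: some $j>i$, $\chi(i,j)$, ($i\lessdot j$ or $i\doteq j$), $\theta$ at $j$; $\ominus^d_\chi\theta$: some $j<i$, $\chi(j,i)$, ($j\lessdot i$ or $j\doteq i$), $\theta$ at $j$. DSP between $i\le j$: $i=i_1<\dots<i_n=j$ with $i_{p+1}=\max\{h\le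 j\mid\chi(i_p,h),\ i_p\lessdot h\text{ or }i_p\doteq h\}$ if nonempty, else $i_{p+1}=i_p+1$ with $i_p\lessdot i_p+1$ or $i_p\doteq i_p+1$. $\theta_1\,\mathcal{U}^d_\chi\,\theta_2$ at $i$: some $j\ge i$, DSP between $i$ and $j$, $\theta_2$ at $j$, $\theta_1$ at other path positions; $\theta_1\,\mathcal{S}^d_\chi\,\theta_2$: some $j\le i$, DSP between $j$ and $i$, $\theta_2$ at $j$, $\theta_1$ elsewhere. $\bigcirc^u_H\theta$: some $h<i$ with $\chi(h,i)$, $h\lessdot i$, and $j=\min\{k>i\mid\chi(h,k),h\lessdot k\}$ exists with $\theta$ at $j$; $\ominus^u_H\theta$: same with $j=\max\{k<i\mid\chi(h,k),h\lessdot k\}$. UHP between $i\le j$: $i=i_1<\dots<i_n=j$ with some $h<i$ s.t. $\chi(h,i_p)$, $h\lessdot i_p$ for all $p$, and no $k$ with $i_q<k<i_{q+1}$, $\chi(h,k)$. $\theta_1\,\mathcal{U}^u_H\,\theta_2$ at $i$: some $j\ge i$ and UHP between $i$ and $j$, $\theta_2$ at $j$, $\theta_1$ elsewhere; $\theta_1\,\mathcal{S}^u_H\,\theta_2$: some $j\le i$ and UHP between $j$ and $i$, $\theta_2$ at $j$, $\theta_1$ elsewhere. Restricted operators (POTL-definable as disjunctions over pairs of labels): $\bigcirc^{\pi}_\chi\theta$ ($\pi\in\{\lessdot,\doteq\}$): some $j$ with $\chi(i,j)$, $i\mathrel{\pi}j$, $\theta$ at $j$; $\ominus^{\pi}_\chi\theta$: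 some $j<i$ with $\chi(j,i)$, $j\mathrel{\pi}i$, $\theta$ at $j$; $\bigcirc^{\lessdot}\theta$: $i\lessdot i+1$, $\theta$ at $i+1$; $\ominus^{\lessdot}\theta$: $i-1\lessdot i$, $\theta$ at $i-1$. Translation $\iota$ from $\mathcal{X}_{until}$ to POTL, recursively, with $\varphi'=\iota(\varphi)$, $\psi'=\iota(\psi)$: identity on atomic propositions, $\top$, $\neg$, $\land$; $\iota(\Downarrow(\varphi,\psi))=\bigcirc^d(\varphi'\mathcal{U}^d_\chi\psi')\lor\bigcirc^d_\chi(\varphi'\mathcal{U}^d_\chi\psi')$; $\iota(\Uparrow(\varphi,\psi))=\ominus^d(\varphi'\mathcal{S}^d_\chi\psi')\lor\ominus^d_\chi(\varphi'\mathcal{S}^d_\chi\psi')$; $\iota(\Rightarrow(\varphi,\psi))=\bigcirc^u_H(\varphi'\mathcal{U}^u_H\psi')\lor(\neg\bigcirc^u_H(\top\,\mathcal{U}^u_H\neg\varphi')\land\ominus^{\lessdot}_\chi(\bigcirc^{\doteq}_\chi\psi'))\lor\ominus^{\lessdot}(\bigcirc^{\lessdot}_\chi(\psi'\land\neg\ominus^u_H(\top\,\mathcal{S}^u_H\neg\varphi')))\lor\ominus^{\lessdot}(\bigcirc^{\doteq}_\chi\psi'\land\neg\bigcirc^{\lessdot}_\chi\neg\varphi')$; $\iota(\Leftarrow(\varphi,\psi))$ as in the claim. -}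

module Defs where

open import Data.Nat using (ℕ; zero; suc; _≤_; _<_)
open import Data.Fin using (Fin)
open import Data.Fin.Subset using (Subset; _∈_)
open import Data.List using (List; []; _∷_; length)
open import Data.Maybe using (Maybe; just; nothing)
open import Data.Product using (Σ; _×_; _,_)
open import Data.Sum using (_⊎_)
open import Data.Unit using (⊤)
open import Data.Empty using (⊥)
open import Relation.Nullary using (¬_)
open import Relation.Binary.PropositionalEquality using (_≡_)
open import Relation.Binary.Construct.Closure.Transitive using (TransClosure)

-- Atomic propositions AP = Fin k ; Σ = 2^AP = Subset k ;
-- symbols of #w# : Sym k = Maybe (Subset k), where nothing = #.

Sym : ℕ → Set
Sym k = Maybe (Subset k)

data Prec : Set where
  lt eq gt : Prec

record OPM (k : ℕ) : Set where
  field
    M       : Sym k → Sym k → Maybe Prec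
    hash-lt : ∀ (a : Subset k) → M nothing (just a) ≡ just lt
    gt-hash : ∀ (a : Subset k) → M (just a) nothing ≡ just gt

data Atom (k : ℕ) : Set where
  ap   : Fin k → Atom k
  hash : Atom k

holds : ∀ {k} → Atom k → Sym k → Set
holds (ap a) (just s) = a ∈ s
holds (ap a) nothing  = ⊥
holds hash   nothing  = ⊤
holds hash   (just _) = ⊥

-- symbol at position i of #w# (positions 0 .. length w + 1; # at both ends)
symAt : ∀ {k} → List (Subset k) → ℕ → Sym k
symAt w zero = nothing
symAt [] (suc i) = nothing
symAt (a ∷ w) (suc zero) = just a
symAt (a ∷ w) (suc (suc i)) = symAt w (suc i)

data Dir : Set where
  down up right left : Dir   -- ⇓ ⇑ ⇒ ⇐

data XF (k : ℕ) : Set where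
  xatom : Atom k → XF k
  xtrue : XF k
  xnot  : XF k → XF k
  xand  : XF k → XF k → XF k
  xmod  : Dir → XF k → XF k → XF k

-- POTL (the operators used by the translation ι)
data PF (k : ℕ) : Set where
  patom   : Atom k → PF k
  ptrue   : PF k
  pnot    : PF k → PF k
  pand    : PF k → PF k → PF k
  por     : PF k → PF k → PF k
  nextD   : PF k → PF k
  prevD   : PF k → PF k
  nextDχ  : PF k → PF k
  prevDχ  : PF k → PF k
  untilDχ : PF k → PF k → PF k
  sinceDχ : PF k → PF k → PF k
  nextH   : PF k → PF k
  prevH   : PF k → PF k
  untilH  : PF k → PF k → PF k
  sinceH  : PF k → PF k → PF k
  nextχ   : Prec → PF k → PF k
  prevχ   : Prec → PF k → PF k
  nextLt  : PF k → PF k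
  prevLt  : PF k → PF k

ι : ∀ {k} → XF k → PF k
ι (xatom a) = patom a
ι xtrue = ptrue
ι (xnot φ) = pnot (ι φ)
ι (xand φ ψ) = pand (ι φ) (ι ψ)
ι (xmod down φ ψ) =
  por (nextD (untilDχ (ι φ) (ι ψ))) (nextDχ (untilDχ (ι φ) (ι ψ)))
ι (xmod up φ ψ) =
  por (prevD (sinceDχ (ι φ) (ι ψ))) (prevDχ (sinceDχ (ι φ) (ι ψ)))
ι (xmod right φ ψ) =
  por (nextH (untilH (ι φ) (ι ψ)))
  (por (pand (pnot (nextH (untilH ptrue (pnot (ι φ)))))
             (prevχ lt (nextχ eq (ι ψ))))
  (por (prevLt (nextχ lt (pand (ι ψ) (pnot (prevH (sinceH ptrue (pnot (ι φ))))))))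
       (prevLt (pand (nextχ eq (ι ψ)) (pnot (nextχ lt (pnot (ι φ))))))))
ι (xmod left φ ψ) =
  por (prevH (sinceH (ι φ) (ι ψ)))
  (por (prevχ eq (nextχ lt (pand (pnot (nextH ptrue)) (sinceH (ι φ) (ι ψ)))))
  (por (pand (prevχ lt (nextLt (ι ψ))) (pnot (prevH (sinceH ptrue (pnot (ι φ))))))
       (prevχ eq (pand (nextLt (ι ψ)) (pnot (nextχ lt (pnot (ι φ))))))))

-- Generic finite increasing paths  i = i₁ → … → iₙ = j

data Path (Step : ℕ → ℕ → Set) (j : ℕ) : ℕ → Set where
  here  : Path Step j j
  there : ∀ {i i'} → Step i i' → Path Step j i' → Path Step j i

module _ {Step : ℕ → ℕ → Set} {j : ℕ} (A : ℕ → Set) where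
  allPos : ∀ {i} → Path Step j i → Set
  allPos here = A j
  allPos (there {i} _ p) = A i × allPos p
  allInit : ∀ {i} → Path Step j i → Set
  allInit here = ⊤
  allInit (there {i} _ p) = A i × allInit p
  allTail : ∀ {i} → Path Step j i → Set
  allTail here = ⊤
  allTail (there _ p) = allPos p

module OPWord {k : ℕ} (O : OPM k) (w : List (Subset k)) where
  open OPM O

  N : ℕ
  N = suc (length w)

  sym : ℕ → Sym k
  sym = symAt w

  Pr : ℕ → Prec → ℕ → Set
  Pr i π j = M (sym i) (sym j) ≡ just π

  Leq : ℕ → ℕ → Set
  Leq i j = Pr i lt j ⊎ Pr i eq j

  -- Chains (simple or composed) in #w#, with left context i and right context j:
  -- c₀ = i ⋖ c₁ ≐ … ≐ c_ℓ ⋗ c_{ℓ+1} = j, ℓ ≥ 1, with each gap between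
  -- consecutive cₖ, cₖ₊₁ either empty or itself a chain.
  data Chain : ℕ → ℕ → Set
  data Gap   : ℕ → ℕ → Set
  data Tail  : ℕ → ℕ → Set

  data Chain where
    chain : ∀ {i p j} → Pr i lt p → Gap i p → Tail p j → Chain i j

  data Gap where
    adj  : ∀ {a} → Gap a (suc a)
    nest : ∀ {a b} → Chain a b → Gap a b

  data Tail where
    last : ∀ {p j} → Pr p gt j → Gap p j → Tail p j
    more : ∀ {p q j} → Pr p eq q → Gap p q → Tail q j → Tail p j

  Defined : ℕ → ℕ → Set
  Defined i j = Σ Prec λ π → Pr i π j

  Compatible : Set
  Compatible =
    (∀ i → 1 ≤ i → suc i ≤ length w → Defined i (suc i)) ×
    (∀ i j → j ≤ N → Chain i j → Defined i j)

  χ : ℕ → ℕ → Set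
  χ i j = j ≤ N × suc i < j × Chain i j

  -- The tree τ(w): node τ(i) is identified with position i.

  Child : ℕ → ℕ → Set
  Child i j =
    (suc i ≤ N × Pr i eq (suc i) × j ≡ suc i) ⊎
    (suc i ≤ N × Pr i lt (suc i) × (j ≡ suc i ⊎ (χ i j × Leq i j)))

  NextSib : ℕ → ℕ → Set
  NextSib a b = Σ ℕ λ i → Child i a × Child i b × a < b ×
                (∀ m → a < m → m < b → ¬ Child i m)

  R : Dir → ℕ → ℕ → Set
  R down  s t = Child s t
  R up    s t = Child t s
  R right s t = NextSib s t
  R left  s t = NextSib t s

  R⁺ : Dir → ℕ → ℕ → Set
  R⁺ d = TransClosure (R d)

  TSat : XF k → ℕ → Set
  TSat (xatom a) s = holds a (sym s)
  TSat xtrue s = ⊤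
  TSat (xnot φ) s = ¬ TSat φ s
  TSat (xand φ ψ) s = TSat φ s × TSat ψ s
  TSat (xmod d φ ψ) s =
    Σ ℕ λ t → R⁺ d s t × TSat ψ t × (∀ r → R⁺ d s r → R⁺ d r t → TSat φ r)

  -- one step of a downward summary path towards j
  DStep : ℕ → ℕ → ℕ → Set
  DStep j i i' = i < j ×
    ((χ i i' × Leq i i' × i' ≤ j × (∀ h → h ≤ j → χ i h → Leq i h → h ≤ i')) ⊎
     ((∀ h → h ≤ j → χ i h → ¬ Leq i h) × i' ≡ suc i × Leq i (suc i)))

  -- one step of an upward hierarchical path w.r.t. h
  HStep : ℕ → ℕ → ℕ → Set
  HStep h i i' = i < i' × (∀ m → i < m → m < i' → ¬ χ h m)

  PSat : PF k → ℕ → Set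
  PSat (patom a) i = holds a (sym i)
  PSat ptrue i = ⊤
  PSat (pnot θ) i = ¬ PSat θ i
  PSat (pand θ η) i = PSat θ i × PSat η i
  PSat (por θ η) i = PSat θ i ⊎ PSat η i
  PSat (nextD θ) i = suc i ≤ N × Leq i (suc i) × PSat θ (suc i)
  PSat (prevD θ) i = Σ ℕ λ h → suc h ≡ i × Leq h i × PSat θ h
  PSat (nextDχ θ) i = Σ ℕ λ j → i < j × χ i j × Leq i j × PSat θ j
  PSat (prevDχ θ) i = Σ ℕ λ j → j < i × χ j i × Leq j i × PSat θ j
  PSat (untilDχ θ η) i = Σ ℕ λ j → j ≤ N × i ≤ j ×
    Σ (Path (DStep j) j i) λ p → PSat η j × allInit (PSat θ) p
  PSat (sinceDχ θ η) i = Σ ℕ λ j → j ≤ i ×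
    Σ (Path (DStep i) i j) λ p → PSat η j × allTail (PSat θ) p
  PSat (nextH θ) i = Σ ℕ λ h → h < i × χ h i × Pr h lt i ×
    Σ ℕ λ j → (i < j × χ h j × Pr h lt j ×
               (∀ m → i < m → χ h m → Pr h lt m → j ≤ m)) × PSat θ j
  PSat (prevH θ) i = Σ ℕ λ h → h < i × χ h i × Pr h lt i ×
    Σ ℕ λ j → (j < i × χ h j × Pr h lt j ×
               (∀ m → m < i → χ h m → Pr h lt m → m ≤ j)) × PSat θ j
  PSat (untilH θ η) i = Σ ℕ λ j → i ≤ j × Σ ℕ λ h → h < i ×
    Σ (Path (HStep h) j i) λ p →
      allPos (λ m → χ h m × Pr h lt m) p × PSat η j × allInit (PSat θ) p
  PSat (sinceH θ η) i = Σ ℕ λ j → j ≤ i × Σ ℕ λ h → h < j ×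
    Σ (Path (HStep h) i j) λ p →
      allPos (λ m → χ h m × Pr h lt m) p × PSat η j × allTail (PSat θ) p
  PSat (nextχ π θ) i = Σ ℕ λ j → χ i j × Pr i π j × PSat θ j
  PSat (prevχ π θ) i = Σ ℕ λ j → χ j i × Pr j π i × PSat θ j
  PSat (nextLt θ) i = suc i ≤ N × Pr i lt (suc i) × PSat θ (suc i)
  PSat (prevLt θ) i = Σ ℕ λ h → suc h ≡ i × Pr h lt i × PSat θ h

{-# OPTIONS --safe #-}
-- The children of τ(h) are h+1, then the positions r with χ(h, r) and h ⋖ r in
-- increasing order, possibly followed by one r with χ(h, r) and h ≐ r.  Hence the
-- left sibling t witnessing ⇐(φ, ψ) at s is h+1 or a ⋖-child, and s is a ⋖-child
-- or the ≐-child, which gives four normal forms, one per disjunct of ι(⇐(φ, ψ)).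
-- Since chains never cross, no position in χ-relation with h lies strictly inside
-- the tail of a chain from h, so the paths of the hierarchical operators run
-- exactly through the ⋖-children of h, in the sibling order.  The negated
-- disjuncts only yield ¬¬φ′; on a finite word the tree semantics is decidable,
-- and the hypothesis on φ transports this decidability to φ′.
module Submission where

open import Defs
open import Data.Nat using (ℕ; zero; suc; _≤_; _<_; _≮_; z≤n; s≤s; _∸_; _≤?_; _<?_; _≟_)
open import Data.Nat.Properties
open import Data.Fin.Subset using (Subset)
open import Data.Fin.Subset.Properties using (_∈?_)
open import Data.List using (List)
open import Data.Maybe using (Maybe; just; nothing)
open import Data.Maybe.Properties using (≡-dec)
open import Data.Product using (Σ; _×_; _,_; proj₁; proj₂)
open import Data.Sum using (_⊎_; inj₁; inj₂)
open import Data.Empty using (⊥; ⊥-elim)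
open import Data.Unit using (tt)
open import Relation.Nullary using (¬_; Dec; yes; no)
open import Relation.Nullary.Decidable using (_×-dec_; _⊎-dec_; _→-dec_; ¬?; map′; decidable-stable)
open import Relation.Binary.PropositionalEquality using (_≡_; refl)
open import Relation.Binary.Definitions using (tri<; tri≈; tri>)
open import Relation.Binary.Construct.Closure.Transitive using (TransClosure; [_]; _∷_)
open import Function.Base using (_∘_)
open import Function.Bundles using (_⇔_; Equivalence; mk⇔)
open import Function.Construct.Composition using (_⇔-∘_)
open import Function.Construct.Symmetry using (⇔-sym)

private
  between-suc : ∀ {a b} → a < b → b < suc a → ⊥
  between-suc a<b b<1+a = <⇒≱ a<b (≤-pred b<1+a)

  lt-eq-clash : ∀ {x : Maybe Prec} → x ≡ just lt → x ≡ just eq → ⊥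
  lt-eq-clash refl ()

  lt-gt-clash : ∀ {x : Maybe Prec} → x ≡ just lt → x ≡ just gt → ⊥
  lt-gt-clash refl ()

  eq-gt-clash : ∀ {x : Maybe Prec} → x ≡ just eq → x ≡ just gt → ⊥
  eq-gt-clash refl ()

  leq-gt-clash : ∀ {x : Maybe Prec} → x ≡ just lt ⊎ x ≡ just eq → x ≡ just gt → ⊥
  leq-gt-clash (inj₁ x≡lt) = lt-gt-clash x≡lt
  leq-gt-clash (inj₂ x≡eq) = eq-gt-clash x≡eq

module ChainGeometry {k : ℕ} (O : OPM k) (w : List (Subset k)) where
  open OPWord O w

  private variable
    a b c d h m m' p : ℕ

  Gap⇒< : Gap a b → a < b
  Chain⇒1+< : Chain a b → suc a < b
  Tail⇒< : Tail a b → a < b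
  Gap⇒< adj = ≤-refl
  Gap⇒< (nest ch) = <⇒≤ (Chain⇒1+< ch)
  Chain⇒1+< (chain _ g tl) = ≤-<-trans (Gap⇒< g) (Tail⇒< tl)
  Tail⇒< (last _ g) = Gap⇒< g
  Tail⇒< (more _ g tl) = <-trans (Gap⇒< g) (Tail⇒< tl)

  Chain⇒⋖1+ : Chain a b → Pr a lt (suc a)
  Chain⇒⋖1+ (chain a⋖p adj _) = a⋖p
  Chain⇒⋖1+ (chain _ (nest ch) _) = Chain⇒⋖1+ ch

  Chain⇒⋗-end : Chain a (suc b) → Pr b gt (suc b)
  Tail⇒⋗-end : Tail a (suc b) → Pr b gt (suc b)
  Chain⇒⋗-end (chain _ _ tl) = Tail⇒⋗-end tl
  Tail⇒⋗-end (last p⋗ adj) = p⋗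
  Tail⇒⋗-end (last _ (nest ch)) = Chain⇒⋗-end ch
  Tail⇒⋗-end (more _ _ tl) = Tail⇒⋗-end tl

  Chain-first : Chain a b → ℕ
  Chain-first (chain {p = p} _ _ _) = p

  Chain-first-> : (ch : Chain a b) → a < Chain-first ch
  Chain-first-> (chain _ g _) = Gap⇒< g

  Chain-first-⋖ : (ch : Chain a b) → Pr a lt (Chain-first ch)
  Chain-first-⋖ (chain a⋖p _ _) = a⋖p

  data Shape : Set where
    ⟨chain⟩ ⟨tail⟩ : Shape

  Segment : Shape → ℕ → ℕ → Set
  Segment ⟨chain⟩ = Chain
  Segment ⟨tail⟩ = Tail

  Segment⇒⋗-end : ∀ {u} → Segment u a (suc b) → Pr b gt (suc b)
  Segment⇒⋗-end {u = ⟨chain⟩} = Chain⇒⋗-end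
  Segment⇒⋗-end {u = ⟨tail⟩} = Tail⇒⋗-end

  no-crossing : ∀ {u v} → Segment u a b → Segment v c d → a < c → c < b → b < d → ⊥
  shared-end⇒⋗ : ∀ {u} → Segment u a b → Chain c b → a < c → Pr c gt b
  Tail∧Chain⇒⋗ : Tail p b → Chain p b → Pr p gt b
  earlier-end⇒⋖ : Chain h m → Chain h m' → m < m' → Pr h lt m
  Tail-≮ : Tail p m → Tail p m' → m ≮ m'

  no-crossing {b = b} {v = ⟨chain⟩} X (chain {p = p} c⋖p g tl) a<c c<b b<d with <-cmp b p
  ... | tri> _ _ p<b = no-crossing X tl (<-trans a<c (Gap⇒< g)) p<b b<d
  no-crossing X (chain _ adj _) _ c<b _ | tri< b<p _ _ = between-suc c<b b<p
  no-crossing X (chain _ (nest ch) _) a<c c<b _ | tri< b<p _ _ = no-crossing X ch a<c c<b b<p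
  no-crossing X (chain c⋖p adj _) _ _ _ | tri≈ _ refl _ = lt-gt-clash c⋖p (Segment⇒⋗-end X)
  no-crossing X (chain c⋖p (nest ch) _) a<c _ _ | tri≈ _ refl _ = lt-gt-clash c⋖p (shared-end⇒⋗ X ch a<c)
  no-crossing {v = ⟨tail⟩} X (last _ adj) _ c<b b<d = between-suc c<b b<d
  no-crossing {v = ⟨tail⟩} X (last _ (nest ch)) a<c c<b b<d = no-crossing X ch a<c c<b b<d
  no-crossing {b = b} {v = ⟨tail⟩} X (more {q = q} c≐q g tl) a<c c<b b<d with <-cmp b q
  ... | tri> _ _ q<b = no-crossing X tl (<-trans a<c (Gap⇒< g)) q<b b<d
  no-crossing X (more _ adj _) _ c<b _ | tri< b<q _ _ = between-suc c<b b<q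
  no-crossing X (more _ (nest ch) _) a<c c<b _ | tri< b<q _ _ = no-crossing X ch a<c c<b b<q
  no-crossing X (more c≐q adj _) _ _ _ | tri≈ _ refl _ = eq-gt-clash c≐q (Segment⇒⋗-end X)
  no-crossing X (more c≐q (nest ch) _) a<c _ _ | tri≈ _ refl _ = eq-gt-clash c≐q (shared-end⇒⋗ X ch a<c)

  shared-end⇒⋗ {c = c} {u = ⟨chain⟩} (chain {p = p} _ g tl) Y a<c with <-cmp c p
  ... | tri≈ _ refl _ = Tail∧Chain⇒⋗ tl Y
  ... | tri> _ _ p<c = shared-end⇒⋗ tl Y p<c
  shared-end⇒⋗ (chain _ adj _) _ a<c | tri< c<p _ _ = ⊥-elim (between-suc a<c c<p)
  shared-end⇒⋗ (chain _ (nest ch) tl) Y a<c | tri< c<p _ _ =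
    ⊥-elim (no-crossing ch Y a<c c<p (Tail⇒< tl))
  shared-end⇒⋗ {u = ⟨tail⟩} (last _ adj) Y a<c =
    ⊥-elim (between-suc a<c (<-trans (n<1+n _) (Chain⇒1+< Y)))
  shared-end⇒⋗ {u = ⟨tail⟩} (last _ (nest ch)) Y a<c = shared-end⇒⋗ ch Y a<c
  shared-end⇒⋗ {c = c} {u = ⟨tail⟩} (more {q = q} _ g tl) Y a<c with <-cmp c q
  ... | tri≈ _ refl _ = Tail∧Chain⇒⋗ tl Y
  ... | tri> _ _ q<c = shared-end⇒⋗ tl Y q<c
  shared-end⇒⋗ (more _ adj _) _ a<c | tri< c<q _ _ = ⊥-elim (between-suc a<c c<q)
  shared-end⇒⋗ (more _ (nest ch) tl) Y a<c | tri< c<q _ _ =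
    ⊥-elim (no-crossing ch Y a<c c<q (Tail⇒< tl))

  Tail∧Chain⇒⋗ (last p⋗b _) _ = p⋗b
  Tail∧Chain⇒⋗ (more {q = q} p≐q g tl) Y with <-cmp (Chain-first Y) q
  ... | tri≈ _ refl _ = ⊥-elim (lt-eq-clash (Chain-first-⋖ Y) p≐q)
  Tail∧Chain⇒⋗ (more _ adj _) Y | tri< r<q _ _ = ⊥-elim (between-suc (Chain-first-> Y) r<q)
  Tail∧Chain⇒⋗ (more p≐q (nest cq) tl) Y | tri< _ _ _ =
    ⊥-elim (lt-eq-clash (earlier-end⇒⋖ cq Y (Tail⇒< tl)) p≐q)
  Tail∧Chain⇒⋗ (more _ g _) (chain _ adj _) | tri> _ _ q<r = ⊥-elim (between-suc (Gap⇒< g) q<r)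
  Tail∧Chain⇒⋗ (more p≐q adj _) (chain _ (nest cr) _) | tri> _ _ _ =
    ⊥-elim (lt-eq-clash (Chain⇒⋖1+ cr) p≐q)
  Tail∧Chain⇒⋗ (more p≐q (nest cq) _) (chain _ (nest cr) _) | tri> _ _ q<r =
    ⊥-elim (lt-eq-clash (earlier-end⇒⋖ cq cr q<r) p≐q)

  earlier-end⇒⋖ {m = m} X (chain {p = c₁} h⋖c₁ g tl) m<m' with <-cmp m c₁
  ... | tri≈ _ refl _ = h⋖c₁
  earlier-end⇒⋖ X (chain _ adj _) _ | tri< m<c₁ _ _ =
    ⊥-elim (between-suc (<-trans (n<1+n _) (Chain⇒1+< X)) m<c₁)
  earlier-end⇒⋖ X (chain _ (nest ch) _) _ | tri< m<c₁ _ _ = earlier-end⇒⋖ X ch m<c₁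
  earlier-end⇒⋖ (chain {p = d₁} _ g' tl') (chain {p = c₁} _ g tl) m<m' | tri> _ _ c₁<m
    with <-cmp d₁ c₁
  ... | tri≈ _ refl _ = ⊥-elim (Tail-≮ tl' tl m<m')
  earlier-end⇒⋖ (chain _ g' _) (chain _ adj _) _ | tri> _ _ _ | tri< d₁<c₁ _ _ =
    ⊥-elim (between-suc (Gap⇒< g') d₁<c₁)
  earlier-end⇒⋖ (chain _ g' tl') (chain _ (nest ch) _) _ | tri> _ _ c₁<m | tri< d₁<c₁ _ _ =
    ⊥-elim (no-crossing ch tl' (Gap⇒< g') d₁<c₁ c₁<m)
  earlier-end⇒⋖ (chain _ adj _) (chain _ g _) _ | tri> _ _ _ | tri> _ _ c₁<d₁ =
    ⊥-elim (between-suc (Gap⇒< g) c₁<d₁)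
  earlier-end⇒⋖ (chain _ (nest ch) tl') (chain _ g tl) m<m' | tri> _ _ _ | tri> _ _ c₁<d₁ =
    ⊥-elim (no-crossing ch tl (Gap⇒< g) c₁<d₁ (<-trans (Tail⇒< tl') m<m'))

  Tail-≮ (last _ g) (last _ adj) m<m' = between-suc (Gap⇒< g) m<m'
  Tail-≮ (last p⋗m adj) (last _ (nest ch')) _ = lt-gt-clash (Chain⇒⋖1+ ch') p⋗m
  Tail-≮ (last p⋗m (nest ch)) (last _ (nest ch')) m<m' = lt-gt-clash (earlier-end⇒⋖ ch ch' m<m') p⋗m
  Tail-≮ {m = m} (last p⋗m g) (more {q = q'} p≐q' g' _) _ with <-cmp m q'
  ... | tri≈ _ refl _ = eq-gt-clash p≐q' p⋗m
  Tail-≮ (last _ g) (more _ adj _) _ | tri< m<q' _ _ = between-suc (Gap⇒< g) m<q'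
  Tail-≮ (last p⋗m adj) (more _ (nest cq') _) _ | tri< _ _ _ = lt-gt-clash (Chain⇒⋖1+ cq') p⋗m
  Tail-≮ (last p⋗m (nest ch)) (more _ (nest cq') _) _ | tri< m<q' _ _ =
    lt-gt-clash (earlier-end⇒⋖ ch cq' m<q') p⋗m
  Tail-≮ (last _ adj) (more _ g' _) _ | tri> _ _ q'<m = between-suc (Gap⇒< g') q'<m
  Tail-≮ (last _ (nest ch)) (more p≐q' adj _) _ | tri> _ _ _ = lt-eq-clash (Chain⇒⋖1+ ch) p≐q'
  Tail-≮ (last _ (nest ch)) (more p≐q' (nest cq') _) _ | tri> _ _ q'<m =
    lt-eq-clash (earlier-end⇒⋖ cq' ch q'<m) p≐q'
  Tail-≮ (more _ g tl) (last _ adj) m<m' = between-suc (<-trans (Gap⇒< g) (Tail⇒< tl)) m<m'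
  Tail-≮ (more p≐q adj _) (last _ (nest ch')) _ = lt-eq-clash (Chain⇒⋖1+ ch') p≐q
  Tail-≮ (more p≐q (nest cq) tl) (last _ (nest ch')) m<m' =
    lt-eq-clash (earlier-end⇒⋖ cq ch' (<-trans (Tail⇒< tl) m<m')) p≐q
  Tail-≮ (more {q = q} _ g tl) (more {q = q'} _ g' tl') m<m' with <-cmp q q'
  ... | tri≈ _ refl _ = Tail-≮ tl tl' m<m'
  Tail-≮ (more _ g _) (more _ adj _) _ | tri< q<q' _ _ = between-suc (Gap⇒< g) q<q'
  Tail-≮ (more p≐q adj _) (more _ (nest cq') _) _ | tri< _ _ _ = lt-eq-clash (Chain⇒⋖1+ cq') p≐q
  Tail-≮ (more p≐q (nest cq) _) (more _ (nest cq') _) _ | tri< q<q' _ _ =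
    lt-eq-clash (earlier-end⇒⋖ cq cq' q<q') p≐q
  Tail-≮ (more _ adj _) (more _ g' _) _ | tri> _ _ q'<q = between-suc (Gap⇒< g') q'<q
  Tail-≮ (more _ (nest cq) _) (more p≐q' adj _) _ | tri> _ _ _ = lt-eq-clash (Chain⇒⋖1+ cq) p≐q'
  Tail-≮ (more _ (nest cq) _) (more p≐q' (nest cq') _) _ | tri> _ _ q'<q =
    lt-eq-clash (earlier-end⇒⋖ cq' cq q'<q) p≐q'

module Tree {k : ℕ} (O : OPM k) (w : List (Subset k)) where
  open OPWord O w
  open ChainGeometry O w

  private variable
    h i p r s t x : ℕ

  -- The positions ranged over by the hierarchical operators ○ᵘ_H, ⊖ᵘ_H, Uᵘ_H, Sᵘ_H
  -- with respect to h; they are children of τ(h).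
  χ⋖ : ℕ → ℕ → Set
  χ⋖ h r = χ h r × Pr h lt r

  χ⇒Chain : χ h r → Chain h r
  χ⇒Chain (_ , _ , ch) = ch

  χ⇒≤N : χ h r → r ≤ N
  χ⇒≤N (r≤N , _ , _) = r≤N

  χ⇒< : χ h r → h < r
  χ⇒< (_ , 1+h<r , _) = <-trans (n<1+n _) 1+h<r

  χ⇒1+< : χ h r → suc h < r
  χ⇒1+< (_ , 1+h<r , _) = 1+h<r

  χ⇒1+≤N : χ h r → suc h ≤ N
  χ⇒1+≤N (r≤N , 1+h<r , _) = <⇒≤ (<-≤-trans 1+h<r r≤N)

  Chain⇒χ : Chain h r → r ≤ N → χ h r
  Chain⇒χ ch r≤N = r≤N , Chain⇒1+< ch , ch

  χ-Child : χ h r → Leq h r → Child h r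
  χ-Child c lq = inj₂ (χ⇒1+≤N c , Chain⇒⋖1+ (χ⇒Chain c) , inj₂ (c , lq))

  χ⋖⇒Child : χ⋖ h r → Child h r
  χ⋖⇒Child (c , h⋖r) = χ-Child c (inj₁ h⋖r)

  Child-cases : Child i x → (x ≡ suc i × Leq i (suc i)) ⊎ (χ i x × Leq i x)
  Child-cases (inj₁ (_ , i≐ , refl)) = inj₁ (refl , inj₂ i≐)
  Child-cases (inj₂ (_ , i⋖ , inj₁ refl)) = inj₁ (refl , inj₁ i⋖)
  Child-cases (inj₂ (_ , _ , inj₂ c)) = inj₂ c

  Child⇒< : Child p t → p < t
  Child⇒< c with Child-cases c
  ... | inj₁ (refl , _) = n<1+n _
  ... | inj₂ (c , _) = χ⇒< c

  Child⇒≤N : Child p t → t ≤ N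
  Child⇒≤N (inj₁ (1+p≤N , _ , refl)) = 1+p≤N
  Child⇒≤N (inj₂ (1+p≤N , _ , inj₁ refl)) = 1+p≤N
  Child⇒≤N (inj₂ (_ , _ , inj₂ (c , _))) = χ⇒≤N c

  Child-parent-unique : ∀ {i i' x} → Child i x → Child i' x → i ≡ i'
  Child-parent-unique {i} {i' = i'} c c' with Child-cases c | Child-cases c'
  ... | inj₁ (refl , _) | inj₁ (refl , _) = refl
  ... | inj₁ (refl , lq) | inj₂ (d , _) = ⊥-elim (leq-gt-clash lq (Chain⇒⋗-end (χ⇒Chain d)))
  ... | inj₂ (d , _) | inj₁ (refl , lq) = ⊥-elim (leq-gt-clash lq (Chain⇒⋗-end (χ⇒Chain d)))
  ... | inj₂ (d , lq) | inj₂ (d' , lq') with <-cmp i i'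
  ...   | tri< i<i' _ _ = ⊥-elim (leq-gt-clash lq' (shared-end⇒⋗ (χ⇒Chain d) (χ⇒Chain d') i<i'))
  ...   | tri≈ _ i≡i' _ = i≡i'
  ...   | tri> _ _ i'<i = ⊥-elim (leq-gt-clash lq (shared-end⇒⋗ (χ⇒Chain d') (χ⇒Chain d) i'<i))

  χ⋖-parent-unique : χ⋖ h r → χ⋖ i r → h ≡ i
  χ⋖-parent-unique c c' = Child-parent-unique (χ⋖⇒Child c) (χ⋖⇒Child c')

  χ⋖-before-χ≐ : ∀ {h s r} → χ h s → Pr h eq s → χ⋖ h r → r < s
  χ⋖-before-χ≐ {s = s} {r = r} c h≐s (c' , h⋖r) with <-cmp r s
  ... | tri< r<s _ _ = r<s
  ... | tri≈ _ refl _ = ⊥-elim (lt-eq-clash h⋖r h≐s)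
  ... | tri> _ _ s<r = ⊥-elim (lt-eq-clash (earlier-end⇒⋖ (χ⇒Chain c) (χ⇒Chain c') s<r) h≐s)

  inner-Child⇒χ⋖ : χ h s → Child h r → suc h < r → r < s → χ⋖ h r
  inner-Child⇒χ⋖ c ch 1+h<r r<s with Child-cases ch
  ... | inj₁ (refl , _) = ⊥-elim (<-irrefl refl 1+h<r)
  ... | inj₂ (c' , _) = c' , earlier-end⇒⋖ (χ⇒Chain c') (χ⇒Chain c) r<s

  Gap⋖⇒Child : Gap p x → x ≤ N → Pr p lt x → Child p x
  Gap⋖⇒Child adj x≤N p⋖x = inj₂ (x≤N , p⋖x , inj₁ refl)
  Gap⋖⇒Child (nest ch) x≤N p⋖x = χ⋖⇒Child (Chain⇒χ ch x≤N , p⋖x)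

  no-Child-under-Tail : ∀ {p c s m} → p < c → Tail c s → c < m → m < s → ¬ Child p m
  no-Child-under-Tail p<c tl c<m m<s cm with Child-cases cm
  ... | inj₁ (refl , _) = between-suc p<c c<m
  ... | inj₂ (c , _) = no-crossing (χ⇒Chain c) tl p<c c<m m<s

  Chain-first-NextSib : (ch : Chain p s) → s ≤ N → Leq p s → NextSib (Chain-first ch) s
  Chain-first-NextSib {p} ch@(chain p⋖c₁ g tl) s≤N lq =
    p , Gap⋖⇒Child g (<⇒≤ (<-≤-trans (Tail⇒< tl) s≤N)) p⋖c₁ , χ-Child (Chain⇒χ ch s≤N) lq ,
    Tail⇒< tl , λ m c₁<m m<s → no-Child-under-Tail (Gap⇒< g) tl c₁<m m<s

  earlier-sibling-χ : Chain p s → s ≤ N → Leq p s → Child p t → t < s → R⁺ left s t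
  earlier-sibling-χ {t = t} ch@(chain {p = c₁} _ g tl) s≤N lq ct t<s with <-cmp t c₁
  ... | tri≈ _ refl _ = [ Chain-first-NextSib ch s≤N lq ]
  ... | tri> _ _ c₁<t = ⊥-elim (no-Child-under-Tail (Gap⇒< g) tl c₁<t t<s ct)
  earlier-sibling-χ (chain _ adj _) _ _ ct _ | tri< t<c₁ _ _ = ⊥-elim (between-suc (Child⇒< ct) t<c₁)
  earlier-sibling-χ ch@(chain p⋖c₁ (nest cc) tl) s≤N lq ct _ | tri< t<c₁ _ _ =
    Chain-first-NextSib ch s≤N lq ∷
    earlier-sibling-χ cc (<⇒≤ (<-≤-trans (Tail⇒< tl) s≤N)) (inj₁ p⋖c₁) ct t<c₁

  earlier-sibling : Child p s → Child p t → t < s → R⁺ left s t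
  earlier-sibling cs ct t<s with Child-cases cs
  ... | inj₁ (refl , _) = ⊥-elim (between-suc (Child⇒< ct) t<s)
  ... | inj₂ (c , lq) = earlier-sibling-χ (χ⇒Chain c) (χ⇒≤N c) lq ct t<s

  R⁺left⇒siblings : R⁺ left s t → Σ ℕ λ p → Child p s × Child p t × t < s
  R⁺left⇒siblings [ p , ct , cs , t<s , _ ] = p , cs , ct , t<s
  R⁺left⇒siblings ((p , cy , cs , y<s , _) ∷ rest) with R⁺left⇒siblings rest
  ... | p' , cy' , ct , t<y with Child-parent-unique cy cy'
  ...   | refl = p , cs , ct , <-trans t<y y<s

  -- Sib / First: the ψ-sibling is a χ⋖-child of h or its first child suc h;
  -- ⋖ / ≐: how s hangs from h.  In order, the disjuncts of ι (xmod left φ ψ).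
  module LeftNormalForm (Φ Ψ : ℕ → Set) where
    Sib⋖ Sib≐ First⋖ First≐ LeftNF : ℕ → Set
    Sib⋖ s = Σ ℕ λ h → Σ ℕ λ t → χ⋖ h s × χ⋖ h t × t < s × Ψ t ×
      (∀ r → χ⋖ h r → t < r → r < s → Φ r)
    Sib≐ s = Σ ℕ λ h → Σ ℕ λ t → χ h s × Pr h eq s × χ⋖ h t × Ψ t ×
      (∀ r → χ⋖ h r → t < r → Φ r)
    First⋖ s = Σ ℕ λ h → χ⋖ h s × suc h ≤ N × Pr h lt (suc h) × Ψ (suc h) ×
      (∀ r → χ⋖ h r → r < s → Φ r)
    First≐ s = Σ ℕ λ h → χ h s × Pr h eq s × suc h ≤ N × Pr h lt (suc h) × Ψ (suc h) ×
      (∀ r → χ⋖ h r → Φ r)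
    LeftNF s = Sib⋖ s ⊎ Sib≐ s ⊎ First⋖ s ⊎ First≐ s

  module _ (φ ψ : XF k) where
    open LeftNormalForm (TSat φ) (TSat ψ)

    ⇐⇒LeftNF : TSat (xmod left φ ψ) s → LeftNF s
    ⇐⇒LeftNF {s} (t , s→t , ψt , between) with R⁺left⇒siblings s→t
    ... | p , cps , cpt , t<s with Child-cases cps
    ...   | inj₁ (refl , _) = ⊥-elim (between-suc (Child⇒< cpt) t<s)
    ...   | inj₂ (cs , lqs) = classify (Child-cases cpt) lqs
      where
      φ-between : ∀ r → χ⋖ p r → t < r → r < s → TSat φ r
      φ-between r cr t<r r<s =
        between r (earlier-sibling cps (χ⋖⇒Child cr) r<s) (earlier-sibling (χ⋖⇒Child cr) cpt t<r)

      classify : (t ≡ suc p × Leq p (suc p)) ⊎ (χ p t × Leq p t) → Leq p s → LeftNF s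
      classify (inj₁ (refl , _)) (inj₁ p⋖s) =
        inj₂ (inj₂ (inj₁ (p , (cs , p⋖s) , χ⇒1+≤N cs , Chain⇒⋖1+ (χ⇒Chain cs) , ψt ,
          λ r cr → φ-between r cr (χ⇒1+< (proj₁ cr)))))
      classify (inj₁ (refl , _)) (inj₂ p≐s) =
        inj₂ (inj₂ (inj₂ (p , cs , p≐s , χ⇒1+≤N cs , Chain⇒⋖1+ (χ⇒Chain cs) , ψt ,
          λ r cr → φ-between r cr (χ⇒1+< (proj₁ cr)) (χ⋖-before-χ≐ cs p≐s cr))))
      classify (inj₂ (ct , _)) (inj₁ p⋖s) =
        inj₁ (p , t , (cs , p⋖s) , (ct , earlier-end⇒⋖ (χ⇒Chain ct) (χ⇒Chain cs) t<s) , t<s , ψt ,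
          φ-between)
      classify (inj₂ (ct , _)) (inj₂ p≐s) =
        inj₂ (inj₁ (p , t , cs , p≐s , (ct , earlier-end⇒⋖ (χ⇒Chain ct) (χ⇒Chain cs) t<s) , ψt ,
          λ r cr t<r → φ-between r cr t<r (χ⋖-before-χ≐ cs p≐s cr)))

    siblings⇒⇐ : Child p s → Child p t → t < s → TSat ψ t →
                 (∀ r → Child p r → t < r → r < s → TSat φ r) → TSat (xmod left φ ψ) s
    siblings⇒⇐ {p} cps cpt t<s ψt between = _ , earlier-sibling cps cpt t<s , ψt , φ-on-path
      where
      φ-on-path : ∀ r → R⁺ left _ r → R⁺ left r _ → TSat φ r
      φ-on-path r s→r r→t with R⁺left⇒siblings s→r | R⁺left⇒siblings r→t
      ... | _ , cp's , cp'r , r<s | _ , _ , _ , t<r with Child-parent-unique cp's cps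
      ...   | refl = between r cp'r t<r r<s

    LeftNF⇒⇐ : LeftNF s → TSat (xmod left φ ψ) s
    LeftNF⇒⇐ (inj₁ (h , t , hs , ht , t<s , ψt , φ-between)) =
      siblings⇒⇐ (χ⋖⇒Child hs) (χ⋖⇒Child ht) t<s ψt λ r cr t<r r<s →
        φ-between r (inner-Child⇒χ⋖ (proj₁ hs) cr (<-trans (χ⇒1+< (proj₁ ht)) t<r) r<s) t<r r<s
    LeftNF⇒⇐ (inj₂ (inj₁ (h , t , c , h≐s , ht , ψt , φ-after))) =
      siblings⇒⇐ (χ-Child c (inj₂ h≐s)) (χ⋖⇒Child ht) (χ⋖-before-χ≐ c h≐s ht) ψt
        λ r cr t<r r<s →
        φ-after r (inner-Child⇒χ⋖ c cr (<-trans (χ⇒1+< (proj₁ ht)) t<r) r<s) t<r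
    LeftNF⇒⇐ (inj₂ (inj₂ (inj₁ (h , hs , 1+h≤N , h⋖ , ψt , φ-before)))) =
      siblings⇒⇐ (χ⋖⇒Child hs) (inj₂ (1+h≤N , h⋖ , inj₁ refl)) (χ⇒1+< (proj₁ hs)) ψt
        λ r cr t<r r<s →
        φ-before r (inner-Child⇒χ⋖ (proj₁ hs) cr t<r r<s) r<s
    LeftNF⇒⇐ (inj₂ (inj₂ (inj₂ (h , c , h≐s , 1+h≤N , h⋖ , ψt , φ-all)))) =
      siblings⇒⇐ (χ-Child c (inj₂ h≐s)) (inj₂ (1+h≤N , h⋖ , inj₁ refl)) (χ⇒1+< c) ψt
        λ r cr t<r r<s →
        φ-all r (inner-Child⇒χ⋖ c cr t<r r<s)

module _ {Step : ℕ → ℕ → Set} where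
  _▷_ : ∀ {j j' i} → Path Step j i → Step j j' → Path Step j' i
  here ▷ st = there st here
  there st π ▷ st' = there st (π ▷ st')

  module _ {Q : ℕ → Set} where
    allPos-last : ∀ {j i} (π : Path Step j i) → allPos Q π → Q j
    allPos-last here q = q
    allPos-last (there _ π) (_ , qs) = allPos-last π qs

    allPos-first : ∀ {j i} (π : Path Step j i) → allPos Q π → Q i
    allPos-first here q = q
    allPos-first (there _ _) (q , _) = q

    allPos⇒allTail : ∀ {j i} (π : Path Step j i) → allPos Q π → allTail Q π
    allPos⇒allTail here _ = tt
    allPos⇒allTail (there _ _) (_ , qs) = qs

    allPos-▷ : ∀ {j j' i} (π : Path Step j i) (st : Step j j') →
               allPos Q π → Q j' → allPos Q (π ▷ st)
    allPos-▷ here _ q q' = q , q'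
    allPos-▷ (there _ π) st (q , qs) q' = q , allPos-▷ π st qs q'

    allTail-▷ : ∀ {j j' i} (π : Path Step j i) (st : Step j j') →
                allTail Q π → Q j' → allTail Q (π ▷ st)
    allTail-▷ here _ _ q' = q'
    allTail-▷ (there _ π) st qs q' = allPos-▷ π st qs q'

module Hierarchy {k : ℕ} (O : OPM k) (w : List (Subset k)) where
  open OPWord O w
  open ChainGeometry O w
  open Tree O w

  χ-end-≤-Tail-start : ∀ {h c y t} → h < c → Tail c y → χ h t → t < y → t ≤ c
  χ-end-≤-Tail-start {c = c} {t = t} h<c tl ht t<y with t ≤? c
  ... | yes t≤c = t≤c
  ... | no t≰c = ⊥-elim (no-crossing (χ⇒Chain ht) tl h<c (≰⇒> t≰c) t<y)

  Tail⇒HStep : ∀ {h c y} → h < c → Tail c y → HStep h c y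
  Tail⇒HStep h<c tl = Tail⇒< tl , λ m c<m m<y hm → no-crossing (χ⇒Chain hm) tl h<c c<m m<y

  HPath-covers : ∀ {h j i} {θ : ℕ → Set} (π : Path (HStep h) j i) → allTail θ π →
                 ∀ r → i < r → r ≤ j → χ h r → θ r
  HPath-covers here _ r i<r r≤i _ = ⊥-elim (<⇒≱ i<r r≤i)
  HPath-covers (there {i' = i'} (_ , skips) π) θs r i<r r≤j hr with <-cmp r i'
  ... | tri< r<i' _ _ = ⊥-elim (skips r i<r r<i' hr)
  ... | tri≈ _ refl _ = allPos-first π θs
  ... | tri> _ _ i'<r = HPath-covers π (allPos⇒allTail π θs) r i'<r r≤j hr

  χ⋖-HPath : ∀ {h y t} {θ : ℕ → Set} → Chain h y → Pr h lt y → y ≤ N → χ⋖ h t → t ≤ y →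
             (∀ r → χ⋖ h r → t < r → r ≤ y → θ r) →
             Σ (Path (HStep h) y t) λ π → allPos (χ⋖ h) π × allTail θ π
  χ⋖-HPath ch h⋖y y≤N _ t≤y _ with m≤n⇒m<n∨m≡n t≤y
  ... | inj₂ refl = here , (Chain⇒χ ch y≤N , h⋖y) , tt
  χ⋖-HPath (chain _ adj tl) _ _ (ht , _) _ _ | inj₁ t<y =
    ⊥-elim (<⇒≱ (χ⇒1+< ht) (χ-end-≤-Tail-start ≤-refl tl ht t<y))
  χ⋖-HPath {h} {y} {θ = θ} ch@(chain h⋖c₁ (nest cc) tl) h⋖y y≤N (ht , h⋖t) _ θs | inj₁ t<y
    with χ⋖-HPath {θ = θ} cc h⋖c₁ (<⇒≤ (<-≤-trans (Tail⇒< tl) y≤N)) (ht , h⋖t)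
           (χ-end-≤-Tail-start (Gap⇒< (nest cc)) tl ht t<y)
           (λ r hr t<r r≤c₁ → θs r hr t<r (≤-trans r≤c₁ (<⇒≤ (Tail⇒< tl))))
  ... | π , χ⋖s , θs' =
    π ▷ step , allPos-▷ π step χ⋖s hy , allTail-▷ π step θs' (θs y hy t<y ≤-refl)
    where
    hy : χ⋖ h y
    hy = Chain⇒χ ch y≤N , h⋖y
    step = Tail⇒HStep (Gap⇒< (nest cc)) tl

  last-χ⋖-before : ∀ {h s t} → Chain h s → s ≤ N → χ⋖ h t → t < s →
                   Σ ℕ λ c → χ⋖ h c × t ≤ c × HStep h c s
  last-χ⋖-before (chain _ adj tl) _ (ht , _) t<s =
    ⊥-elim (<⇒≱ (χ⇒1+< ht) (χ-end-≤-Tail-start ≤-refl tl ht t<s))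
  last-χ⋖-before (chain h⋖c (nest cc) tl) s≤N (ht , _) t<s =
    _ , (Chain⇒χ cc (<⇒≤ (<-≤-trans (Tail⇒< tl) s≤N)) , h⋖c) ,
    χ-end-≤-Tail-start (Gap⇒< (nest cc)) tl ht t<s , Tail⇒HStep (Gap⇒< (nest cc)) tl

  next-χ⋖ : ∀ {h r j} → Chain h r → Pr h lt r → r ≤ N → χ⋖ h j → j < r →
            Σ ℕ λ y → j < y × χ h y × Pr h lt y × (∀ m → j < m → χ h m → Pr h lt m → y ≤ m)
  next-χ⋖ {j = j} (chain {p = c₁} _ g tl) _ _ (hj , _) j<r with <-cmp c₁ j
  ... | tri< c₁<j _ _ = ⊥-elim (no-crossing (χ⇒Chain hj) tl (Gap⇒< g) c₁<j j<r)
  next-χ⋖ ch@(chain _ g tl) h⋖r r≤N _ j<r | tri≈ _ refl _ =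
    _ , j<r , Chain⇒χ ch r≤N , h⋖r ,
    λ m j<m hm _ → ≮⇒≥ (λ m<r → no-crossing (χ⇒Chain hm) tl (Gap⇒< g) j<m m<r)
  next-χ⋖ (chain _ adj _) _ _ (hj , _) _ | tri> _ _ j<c₁ = ⊥-elim (between-suc (χ⇒< hj) j<c₁)
  next-χ⋖ (chain h⋖c₁ (nest cc) tl) _ r≤N hj _ | tri> _ _ j<c₁ =
    next-χ⋖ cc h⋖c₁ (<⇒≤ (<-≤-trans (Tail⇒< tl) r≤N)) hj j<c₁

  later-χ⋖⇒nextH⊤ : ∀ {h r j} → χ⋖ h r → χ⋖ h j → j < r → PSat (nextH ptrue) j
  later-χ⋖⇒nextH⊤ {h} (hr , h⋖r) (hj , h⋖j) j<r
    with next-χ⋖ (χ⇒Chain hr) h⋖r (χ⇒≤N hr) (hj , h⋖j) j<r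
  ... | y , next = h , χ⇒< hj , hj , h⋖j , y , next , tt

  module _ {θ η : PF k} where
    open LeftNormalForm (PSat θ) (PSat η)

    sinceH-intro : ∀ {h c t} → χ⋖ h c → χ⋖ h t → t ≤ c → PSat η t →
                   (∀ r → χ⋖ h r → t < r → r ≤ c → PSat θ r) → PSat (sinceH θ η) c
    sinceH-intro {h} {t = t} (hc , h⋖c) ht t≤c ηt θs
      with χ⋖-HPath {θ = PSat θ} (χ⇒Chain hc) h⋖c (χ⇒≤N hc) ht t≤c θs
    ... | π , χ⋖s , θs' = t , t≤c , h , χ⇒< (proj₁ ht) , π , χ⋖s , ηt , θs'

    prevH-sinceH-intro : ∀ {s} → Sib⋖ s → PSat (prevH (sinceH θ η)) s
    prevH-sinceH-intro {s} (h , t , (hs , h⋖s) , ht , t<s , ηt , θs)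
      with last-χ⋖-before (χ⇒Chain hs) (χ⇒≤N hs) ht t<s
    ... | c , hc , t≤c , c<s , skips =
      h , χ⇒< hs , hs , h⋖s , c , (c<s , proj₁ hc , proj₂ hc , maximal) ,
      sinceH-intro hc ht t≤c ηt λ m hm t<m m≤c → θs m hm t<m (≤-<-trans m≤c c<s)
      where
      maximal : ∀ m → m < s → χ h m → Pr h lt m → m ≤ c
      maximal m m<s hm _ = ≮⇒≥ (λ c<m → skips m c<m m<s hm)

    prevH-sinceH-elim : ∀ {s} → PSat (prevH (sinceH θ η)) s → Sib⋖ s
    prevH-sinceH-elim (h , _ , hs , h⋖s , c , (c<s , hc , h⋖c , maximal) ,
                       (t , t≤c , _ , _ , π , χ⋖s , ηt , θs))
      with χ⋖-parent-unique (allPos-last π χ⋖s) (hc , h⋖c)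
    ... | refl = h , t , (hs , h⋖s) , allPos-first π χ⋖s , ≤-<-trans t≤c c<s , ηt ,
                 λ r (hr , h⋖r) t<r r<s → HPath-covers π θs r t<r (maximal r r<s hr h⋖r) hr

TransClosure? : ∀ {R : ℕ → ℕ → Set} → (∀ x y → Dec (R x y)) →
                (bound : ℕ → ℕ) → (∀ {x y} → R x y → y < bound x) →
                (μ : ℕ → ℕ) → (∀ {x y} → R x y → μ y < μ x) →
                ∀ x y → Dec (TransClosure R x y)
TransClosure? {R} R? bound R<bound μ μ-decreasing x = go (μ x) x ≤-refl
  where
  go : ∀ fuel x → μ x ≤ fuel → ∀ y → Dec (TransClosure R x y)
  go fuel x μx≤fuel y with R? x y
  ... | yes r = yes [ r ]
  go zero x μx≤0 y | no ¬r =
    no λ { [ r ] → ¬r r ; (r ∷ _) → <⇒≱ (μ-decreasing r) (≤-trans μx≤0 z≤n) }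
  go (suc fuel) x μx≤fuel y | no ¬r =
    map′ (λ (_ , _ , r , rs) → r ∷ rs)
         (λ { [ r ] → ⊥-elim (¬r r) ; (r ∷ rs) → _ , R<bound r , r , rs })
      (anyUpTo? via? (bound x))
    where
    via? : ∀ z → Dec (R x z × TransClosure R z y)
    via? z with R? x z
    ... | yes r = map′ (r ,_) proj₂ (go fuel z (≤-pred (<-≤-trans (μ-decreasing r) μx≤fuel)) y)
    ... | no ¬r' = no (λ (r , _) → ¬r' r)

module Decidability {k : ℕ} (O : OPM k) (w : List (Subset k)) where
  open OPM O
  open OPWord O w
  open ChainGeometry O w
  open Tree O w

  _≟ₚ_ : (π π' : Prec) → Dec (π ≡ π')
  lt ≟ₚ lt = yes refl
  eq ≟ₚ eq = yes refl
  gt ≟ₚ gt = yes refl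
  lt ≟ₚ eq = no λ ()
  lt ≟ₚ gt = no λ ()
  eq ≟ₚ lt = no λ ()
  eq ≟ₚ gt = no λ ()
  gt ≟ₚ lt = no λ ()
  gt ≟ₚ eq = no λ ()

  Pr? : ∀ i π j → Dec (Pr i π j)
  Pr? i π j = ≡-dec _≟ₚ_ (M (sym i) (sym j)) (just π)

  between? : ∀ {Q : ℕ → Set} a b → (∀ p → a < p → p < b → Dec (Q p)) →
             Dec (Σ ℕ λ p → a < p × p < b × Q p)
  between? {Q} a b Q? =
    map′ (λ (p , _ , q) → p , q) (λ (p , q) → p , proj₁ (proj₂ q) , q) (anyUpTo? P? b)
    where
    P? : ∀ p → Dec (a < p × p < b × Q p)
    P? p with a <? p | p <? b
    ... | yes a<p | yes p<b = map′ (λ q → a<p , p<b , q) (λ (_ , _ , q) → q) (Q? p a<p p<b)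
    ... | no a≮p | _ = no (λ (a<p , _) → a≮p a<p)
    ... | yes _ | no p≮b = no (λ (_ , p<b , _) → p≮b p<b)

  Gap? : ∀ {a b} → Dec (Chain a b) → Dec (Gap a b)
  Gap? {a} {b} chain? with b ≟ suc a
  ... | yes refl = yes adj
  ... | no b≢1+a = map′ nest (λ { adj → ⊥-elim (b≢1+a refl) ; (nest ch) → ch }) chain?

  Chain-Tail? : (fuel : ℕ) → ∀ a b → b ∸ a ≤ fuel → Dec (Chain a b) × Dec (Tail a b)
  Chain-Tail? zero a b b∸a≤0 =
    no (λ ch → b≯a (<-trans (n<1+n _) (Chain⇒1+< ch))) , no (λ tl → b≯a (Tail⇒< tl))
    where
    b≯a : a < b → ⊥
    b≯a a<b = <⇒≱ a<b (m∸n≡0⇒m≤n (n≤0⇒n≡0 b∸a≤0))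
  Chain-Tail? (suc fuel) a b b∸a≤fuel = chain? , tail?
    where
    right-shorter : ∀ p → a < p → p < b → b ∸ p ≤ fuel
    right-shorter p a<p p<b = ≤-pred (<-≤-trans (∸-monoʳ-< a<p (<⇒≤ p<b)) b∸a≤fuel)
    left-shorter : ∀ p → a < p → p < b → p ∸ a ≤ fuel
    left-shorter p a<p p<b = ≤-pred (<-≤-trans (∸-monoˡ-< p<b (<⇒≤ a<p)) b∸a≤fuel)
    split? : ∀ π → Dec (Σ ℕ λ p → a < p × p < b × Pr a π p × Gap a p × Tail p b)
    split? π = between? a b λ p a<p p<b →
      Pr? a π p ×-dec (Gap? (proj₁ (Chain-Tail? fuel a p (left-shorter p a<p p<b)))
                ×-dec proj₂ (Chain-Tail? fuel p b (right-shorter p a<p p<b)))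
    chain? : Dec (Chain a b)
    chain? = map′ (λ (_ , _ , _ , a⋖p , g , tl) → chain a⋖p g tl)
                  (λ { (chain a⋖p g tl) → _ , Gap⇒< g , Tail⇒< tl , a⋖p , g , tl })
                  (split? lt)
    tail? : Dec (Tail a b)
    tail? = map′ (λ { (inj₁ (a⋗b , g)) → last a⋗b g
                    ; (inj₂ (_ , _ , _ , a≐p , g , tl)) → more a≐p g tl })
                 (λ { (last a⋗b g) → inj₁ (a⋗b , g)
                    ; (more a≐p g tl) → inj₂ (_ , Gap⇒< g , Tail⇒< tl , a≐p , g , tl) })
                 ((Pr? a gt b ×-dec Gap? chain?) ⊎-dec split? eq)

  Chain? : ∀ a b → Dec (Chain a b)
  Chain? a b = proj₁ (Chain-Tail? (b ∸ a) a b ≤-refl)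

  χ? : ∀ i j → Dec (χ i j)
  χ? i j = (j ≤? N) ×-dec ((suc i <? j) ×-dec Chain? i j)

  Leq? : ∀ i j → Dec (Leq i j)
  Leq? i j = Pr? i lt j ⊎-dec Pr? i eq j

  Child? : ∀ i j → Dec (Child i j)
  Child? i j = ((suc i ≤? N) ×-dec (Pr? i eq (suc i) ×-dec (j ≟ suc i))) ⊎-dec
               ((suc i ≤? N) ×-dec (Pr? i lt (suc i) ×-dec ((j ≟ suc i) ⊎-dec (χ? i j ×-dec Leq? i j))))

  NextSib? : ∀ a b → Dec (NextSib a b)
  NextSib? a b = map′ (λ (i , _ , sib) → i , sib) (λ (i , sib) → i , Child⇒< (proj₁ sib) , sib)
    (anyUpTo? (λ i → Child? i a ×-dec (Child? i b ×-dec ((a <? b) ×-dec none-between? i))) a)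
    where
    none-between? : ∀ i → Dec (∀ m → a < m → m < b → ¬ Child i m)
    none-between? i = map′ (λ f m a<m m<b → f m<b a<m) (λ f {m} m<b a<m → f m a<m m<b)
                        (allUpTo? (λ m → (a <? m) →-dec ¬? (Child? i m)) b)

  R? : ∀ d x y → Dec (R d x y)
  R? down x y = Child? x y
  R? up x y = Child? y x
  R? right x y = NextSib? x y
  R? left x y = NextSib? y x

  R⇒≤N : ∀ d {x y} → R d x y → y ≤ N
  R⇒≤N down c = Child⇒≤N c
  R⇒≤N up c = <⇒≤ (<-≤-trans (Child⇒< c) (Child⇒≤N c))
  R⇒≤N right (_ , _ , c , _) = Child⇒≤N c
  R⇒≤N left (_ , c , _) = Child⇒≤N c

  R⁺⇒≤N : ∀ d {x y} → R⁺ d x y → y ≤ N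
  R⁺⇒≤N d [ r ] = R⇒≤N d r
  R⁺⇒≤N d (_ ∷ rs) = R⁺⇒≤N d rs

  μ : Dir → ℕ → ℕ
  μ down x = N ∸ x
  μ right x = N ∸ x
  μ up x = x
  μ left x = x

  μ-decreasing : ∀ d {x y} → R d x y → μ d y < μ d x
  μ-decreasing down c = ∸-monoʳ-< (Child⇒< c) (Child⇒≤N c)
  μ-decreasing right (_ , _ , c , x<y , _) = ∸-monoʳ-< x<y (Child⇒≤N c)
  μ-decreasing up c = Child⇒< c
  μ-decreasing left (_ , _ , _ , y<x , _) = y<x

  R⁺? : ∀ d x y → Dec (R⁺ d x y)
  R⁺? d = TransClosure? (R? d) (λ _ → suc N) (λ r → s≤s (R⇒≤N d r)) (μ d) (μ-decreasing d)

  holds? : ∀ (a : Atom k) (x : Sym k) → Dec (holds a x)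
  holds? (ap i) (just s) = i ∈? s
  holds? (ap i) nothing = no λ ()
  holds? hash nothing = yes tt
  holds? hash (just _) = no λ ()

  TSat? : ∀ φ s → Dec (TSat φ s)
  TSat? (xatom a) s = holds? a (sym s)
  TSat? xtrue s = yes tt
  TSat? (xnot φ) s = ¬? (TSat? φ s)
  TSat? (xand φ ψ) s = TSat? φ s ×-dec TSat? ψ s
  TSat? (xmod d φ ψ) s =
    map′ (λ (t , _ , sat) → t , sat) (λ (t , sat) → t , s≤s (R⁺⇒≤N d (proj₁ sat)) , sat)
      (anyUpTo? (λ t → R⁺? d s t ×-dec (TSat? ψ t ×-dec φ-between? t)) (suc N))
    where
    φ-between? : ∀ t → Dec (∀ r → R⁺ d s r → R⁺ d r t → TSat φ r)
    φ-between? t =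
      map′ (λ f r s→r r→t → f (s≤s (R⁺⇒≤N d s→r)) s→r r→t) (λ f {r} _ → f r)
      (allUpTo? (λ r → R⁺? d s r →-dec (R⁺? d r t →-dec TSat? φ r)) (suc N))

module LeftOperator {k : ℕ} (O : OPM k) (w : List (Subset k)) where
  open OPWord O w
  open Tree O w
  open Hierarchy O w
  open LeftNormalForm

  LeftNF-map : ∀ {Φ Φ' Ψ Ψ' : ℕ → Set} →
               (∀ {r} → r ≤ N → Φ r → Φ' r) → (∀ {r} → r ≤ N → Ψ r → Ψ' r) →
               ∀ {s} → LeftNF Φ Ψ s → LeftNF Φ' Ψ' s
  LeftNF-map f g (inj₁ (h , t , hs , ht , t<s , ψt , φs)) =
    inj₁ (h , t , hs , ht , t<s , g (χ⇒≤N (proj₁ ht)) ψt ,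
          λ r hr t<r r<s → f (χ⇒≤N (proj₁ hr)) (φs r hr t<r r<s))
  LeftNF-map f g (inj₂ (inj₁ (h , t , hs , h≐s , ht , ψt , φs))) =
    inj₂ (inj₁ (h , t , hs , h≐s , ht , g (χ⇒≤N (proj₁ ht)) ψt ,
          λ r hr t<r → f (χ⇒≤N (proj₁ hr)) (φs r hr t<r)))
  LeftNF-map f g (inj₂ (inj₂ (inj₁ (h , hs , 1+h≤N , h⋖ , ψt , φs)))) =
    inj₂ (inj₂ (inj₁ (h , hs , 1+h≤N , h⋖ , g 1+h≤N ψt ,
          λ r hr r<s → f (χ⇒≤N (proj₁ hr)) (φs r hr r<s))))
  LeftNF-map f g (inj₂ (inj₂ (inj₂ (h , hs , h≐s , 1+h≤N , h⋖ , ψt , φs)))) =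
    inj₂ (inj₂ (inj₂ (h , hs , h≐s , 1+h≤N , h⋖ , g 1+h≤N ψt ,
          λ r hr → f (χ⇒≤N (proj₁ hr)) (φs r hr))))

  LeftNF-cong : ∀ {Φ Φ' Ψ Ψ' : ℕ → Set} →
                (∀ r → r ≤ N → Φ r ⇔ Φ' r) → (∀ r → r ≤ N → Ψ r ⇔ Ψ' r) →
                ∀ s → LeftNF Φ Ψ s ⇔ LeftNF Φ' Ψ' s
  LeftNF-cong Φ⇔ Ψ⇔ s = mk⇔
    (LeftNF-map (λ {r} → Equivalence.to ∘ Φ⇔ r) (λ {r} → Equivalence.to ∘ Ψ⇔ r))
    (LeftNF-map (λ {r} → Equivalence.from ∘ Φ⇔ r) (λ {r} → Equivalence.from ∘ Ψ⇔ r))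

  ⇐⇔LeftNF : ∀ φ ψ s → TSat (xmod left φ ψ) s ⇔ LeftNF (TSat φ) (TSat ψ) s
  ⇐⇔LeftNF φ ψ s = mk⇔ (⇐⇒LeftNF φ ψ) (LeftNF⇒⇐ φ ψ)

  module _ (φ ψ : XF k) where
    private
      φ' ψ' : PF k
      φ' = ι φ
      ψ' = ι ψ

    LeftNF⇒ι⇐ : ∀ {s} → LeftNF (PSat φ') (PSat ψ') s → PSat (ι (xmod left φ ψ)) s
    LeftNF⇒ι⇐ (inj₁ sib) = inj₁ (prevH-sinceH-intro {θ = φ'} {η = ψ'} sib)
    LeftNF⇒ι⇐ (inj₂ (inj₁ (h , t , hs , h≐s , ht , ψt , φ-after)))
      with last-χ⋖-before (χ⇒Chain hs) (χ⇒≤N hs) ht (χ⋖-before-χ≐ hs h≐s ht)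
    ... | c , hc , t≤c , _ , skips =
      inj₂ (inj₁ (h , hs , h≐s , c , proj₁ hc , proj₂ hc , last-χ⋖ ,
        sinceH-intro {θ = φ'} {η = ψ'} hc ht t≤c ψt λ r hr t<r _ → φ-after r hr t<r))
      where
      last-χ⋖ : ¬ PSat (nextH ptrue) c
      last-χ⋖ (_ , _ , h'c , h'⋖c , y , (c<y , h'y , h'⋖y , _) , _)
        with χ⋖-parent-unique (h'c , h'⋖c) hc
      ... | refl = skips y c<y (χ⋖-before-χ≐ hs h≐s (h'y , h'⋖y)) h'y
    LeftNF⇒ι⇐ {s} (inj₂ (inj₂ (inj₁ (h , (hs , h⋖s) , 1+h≤N , h⋖ , ψ1+h , φ-before)))) =
      inj₂ (inj₂ (inj₁ ((h , hs , h⋖s , 1+h≤N , h⋖ , ψ1+h) , no-¬φ-before)))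
      where
      no-¬φ-before : ¬ PSat (prevH (sinceH ptrue (pnot φ'))) s
      no-¬φ-before sat with prevH-sinceH-elim {θ = ptrue} {η = pnot φ'} sat
      ... | _ , t , h's , ht , t<s , ¬φt , _ with χ⋖-parent-unique h's (hs , h⋖s)
      ...   | refl = ¬φt (φ-before t ht t<s)
    LeftNF⇒ι⇐ (inj₂ (inj₂ (inj₂ (h , hs , h≐s , 1+h≤N , h⋖ , ψ1+h , φ-all)))) =
      inj₂ (inj₂ (inj₂ (h , hs , h≐s , (1+h≤N , h⋖ , ψ1+h) ,
        λ (m , hm , h⋖m , ¬φm) → ¬φm (φ-all m (hm , h⋖m)))))

    ι⇐⇒LeftNF : (∀ r → r ≤ N → ¬ ¬ PSat φ' r → PSat φ' r) →
                ∀ {s} → PSat (ι (xmod left φ ψ)) s → LeftNF (PSat φ') (PSat ψ') s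
    ι⇐⇒LeftNF _ (inj₁ sat) = inj₁ (prevH-sinceH-elim {θ = φ'} {η = ψ'} sat)
    ι⇐⇒LeftNF _ (inj₂ (inj₁ (h , hs , h≐s , j , hj , h⋖j , last-χ⋖ ,
                              (t , t≤j , _ , _ , π , χ⋖s , ψt , φs))))
      with χ⋖-parent-unique (allPos-last π χ⋖s) (hj , h⋖j)
    ... | refl = inj₂ (inj₁ (h , t , hs , h≐s , allPos-first π χ⋖s , ψt , φ-after))
      where
      φ-after : ∀ r → χ⋖ h r → t < r → PSat φ' r
      φ-after r hr t<r with r ≤? j
      ... | yes r≤j = HPath-covers π φs r t<r r≤j (proj₁ hr)
      ... | no r≰j = ⊥-elim (last-χ⋖ (later-χ⋖⇒nextH⊤ hr (hj , h⋖j) (≰⇒> r≰j)))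
    ι⇐⇒LeftNF stable (inj₂ (inj₂ (inj₁ ((h , hs , h⋖s , 1+h≤N , h⋖ , ψ1+h) , no-¬φ-before)))) =
      inj₂ (inj₂ (inj₁ (h , (hs , h⋖s) , 1+h≤N , h⋖ , ψ1+h ,
        λ r hr r<s → stable r (χ⇒≤N (proj₁ hr)) λ ¬φr →
          no-¬φ-before (prevH-sinceH-intro {θ = ptrue} {η = pnot φ'}
                          (h , r , (hs , h⋖s) , hr , r<s , ¬φr , λ _ _ _ _ → tt)))))
    ι⇐⇒LeftNF stable (inj₂ (inj₂ (inj₂ (h , hs , h≐s , (1+h≤N , h⋖ , ψ1+h) , no-¬φ)))) =
      inj₂ (inj₂ (inj₂ (h , hs , h≐s , 1+h≤N , h⋖ , ψ1+h ,
        λ r (hr , h⋖r) → stable r (χ⇒≤N hr) λ ¬φr → no-¬φ (r , hr , h⋖r , ¬φr))))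

    ι⇐⇔LeftNF : (∀ r → r ≤ N → ¬ ¬ PSat φ' r → PSat φ' r) →
                ∀ s → PSat (ι (xmod left φ ψ)) s ⇔ LeftNF (PSat φ') (PSat ψ') s
    ι⇐⇔LeftNF stable s = mk⇔ (ι⇐⇒LeftNF stable) LeftNF⇒ι⇐

lemma4p8 : ∀ {k : ℕ} (O : OPM k) (w : List (Subset k)) →
    OPWord.Compatible O w →
    (φ ψ : XF k) →
    (∀ i' → i' ≤ OPWord.N O w →
       (OPWord.TSat O w φ i' ⇔ OPWord.PSat O w (ι φ) i')) →
    (∀ i' → i' ≤ OPWord.N O w →
       (OPWord.TSat O w ψ i' ⇔ OPWord.PSat O w (ι ψ) i')) →
    ∀ i → i ≤ OPWord.N O w →
      (OPWord.TSat O w (xmod left φ ψ) i ⇔ OPWord.PSat O w (ι (xmod left φ ψ)) i)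
lemma4p8 O w _ φ ψ hφ hψ i _ =
  ⇔-sym (ι⇐⇔LeftNF φ ψ ι-φ-stable i) ⇔-∘ (LeftNF-cong hφ hψ i ⇔-∘ ⇐⇔LeftNF φ ψ i)
  where
  open OPWord O w
  open LeftOperator O w
  open Decidability O w using (TSat?)

  ι-φ-stable : ∀ r → r ≤ N → ¬ ¬ PSat (ι φ) r → PSat (ι φ) r
  ι-φ-stable r r≤N ¬¬φ' = Equivalence.to (hφ r r≤N)
    (decidable-stable (TSat? φ r) λ ¬φ → ¬¬φ' λ φ' → ¬φ (Equivalence.from (hφ r r≤N) φ'))
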